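{- Let $H=(V,E,C,\ell)$ be an edge-colored hypergraph with nonnegative edge weights $w$. Let $\{a_e,b_e,a_u^i,b_u^i\}$ be an optimal solution of the binary linear program $\text{BLP}_\text{CP}$, and for each $e\in E$ define $x_e=\tfrac12(b_e-a_e+1)$. Then $\{x_e\}_{e\in E}$ is an optimal solution of $\text{LP}_\text{VC}$ (in particular the optimal values of $\text{BLP}_\text{CP}$ and $\text{LP}_\text{VC}$ coincide).
   Context: An edge-colored hypergraph $H=(V,E,C,\ell)$ has node set $V$, hyperedge set $E$, color set $C=\{1,\dots,k\}$, and color map $\ell:E\to C$; weights $w(e)\ge0$. For $u\in V$, $C(u)=\{j\in C:\exists e\ni u\text{ with }\ell(e)=j\}$ and $\binom{C(u)}{2}$ is the set of unordered pairs of distinct colors in $C(u)$. A pair $(e,f)$ of hyperedges is a bad edge pair if $e\cap f\ne\emptyset$ and $\ell(e)\ne\ell(f)$; $\mathcal{B}$ is the set of bad edge pairs. $\text{LP}_\text{VC}$: minimize $\sum_{e\in E}w(e)x_e$ subject to $x_e+x_f\ge1$ for all $(e,f)\in\mathcal{B}$, and $x_e\ge0$ for all $e\in E$. $\text{BLP}_\text{CP}$: minimize $\tfrac12\sum_{e\in E}w(e)(b_e-a_e+1)$ subject to: for all $e\in E$ and $u\in e$, $a_e\le a_u^{\ell(e)}$ and $b_u^{\ell(e)}\le b_e$; for all $u\in V$ and $(i,j)\in\binom{C(u)}{2}$, $a_u^i\le b_u^j$ and $a_u^j\le b_u^i$; all variables $a_u^i,b_u^i$ ($u\in V$, $i\in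 C(u)$) and $a_e,b_e$ ($e\in E$) are in $\{0,1\}$.
   Formalization: The edge weights and the variables $x_e$ of $\text{LP}_\text{VC}$, including those of every feasible solution it is compared with, are rational. -}

module Defs where

open import Data.Nat using (ℕ; zero; suc)
open import Data.Fin using (Fin)
import Data.Fin as F
open import Data.Fin.Subset using (Subset; _∈_)
open import Data.Bool using (Bool; true; false)
import Data.Bool as B
open import Data.Rational using (ℚ; 0ℚ; 1ℚ; ½; _+_; _-_; _*_; _≤_)
open import Data.Product using (Σ; ∃; _×_; _,_)
open import Relation.Binary.PropositionalEquality using (_≡_; _≢_)

record Hypergraph : Set where
  field
    n m k   : ℕ
    edge    : Fin m → Subset n
    ℓ       : Fin m → Fin k
    w       : Fin m → ℚ
    w≥0     : ∀ e → 0ℚ ≤ w e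

module _ (H : Hypergraph) where
  open Hypergraph H

  Σℚ : ∀ {j} → (Fin j → ℚ) → ℚ
  Σℚ {zero}  f = 0ℚ
  Σℚ {suc j} f = f F.zero + Σℚ (λ i → f (F.suc i))

  InC : Fin n → Fin k → Set
  InC u j = ∃ λ (e : Fin m) → (u ∈ edge e) × (ℓ e ≡ j)

  Bad : Fin m → Fin m → Set
  Bad e f = (∃ λ (u : Fin n) → (u ∈ edge e) × (u ∈ edge f)) × (ℓ e ≢ ℓ f)

  VCFeasible : (Fin m → ℚ) → Set
  VCFeasible x = (∀ e f → Bad e f → 1ℚ ≤ x e + x f) × (∀ e → 0ℚ ≤ x e)

  VCObj : (Fin m → ℚ) → ℚ
  VCObj x = Σℚ (λ e → w e * x e)

  VCOptimal : (Fin m → ℚ) → Set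
  VCOptimal x = VCFeasible x × (∀ y → VCFeasible y → VCObj x ≤ VCObj y)

  ---------------------------------------------------------------- BLP_CP
  -- binary variables; a_u^i, b_u^i are given for every colour i but only
  -- those with i ∈ C(u) occur in constraints/objective.
  record CPVars : Set where
    field
      aV bV : Fin n → Fin k → Bool
      aE bE : Fin m → Bool

  bit : Bool → ℚ
  bit true  = 1ℚ
  bit false = 0ℚ

  CPFeasible : CPVars → Set
  CPFeasible s =
      (∀ e u → u ∈ edge e → (aE e B.≤ aV u (ℓ e)) × (bV u (ℓ e) B.≤ bE e))
    × (∀ u i j → InC u i → InC u j → i ≢ j →
         (aV u i B.≤ bV u j) × (aV u j B.≤ bV u i))
    where open CPVars s

  xOf : CPVars → Fin m → ℚ
  xOf s e = ½ * (bit (bE e) - bit (aE e) + 1ℚ)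
    where open CPVars s

  CPObj : CPVars → ℚ
  CPObj s = Σℚ (λ e → w e * xOf s e)

  CPOptimal : CPVars → Set
  CPOptimal s = CPFeasible s × (∀ t → CPFeasible t → CPObj s ≤ CPObj t)

-- Every feasible solution y of LP_VC can be replaced by a half-integral one of no larger
-- cost.  Since w ≥ 0 we may first cap y at 1.  Stretching the fractional coordinates
-- about ½ by a factor c, y_e ↦ ½ + c (y_e − ½), keeps y a cover as long as it stays in
-- [0,1], and the cost is affine in c.  So either c = 0 (every fractional coordinate
-- becomes ½) or the largest admissible c, which is ≥ 1 and pushes some coordinate to 0 or
-- 1, costs no more than c = 1; in the second case we recurse on the number of fractional
-- coordinates.  A half-integral cover z yields a feasible BLP_CP solution whose x is z,
-- and conversely the x of a feasible BLP_CP solution is feasible for LP_VC; hence an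
-- optimal BLP_CP solution gives an optimal LP_VC solution.
module Submission where

open import Defs

open import Algebra.Bundles using (Ring)
open import Data.Bool using (true; false)
import Data.Bool as Bool
import Data.Bool.Properties as Bool
open import Data.Empty using (⊥-elim)
open import Data.Fin using (Fin; zero; suc)
import Data.Fin as Fin
open import Data.Fin.Properties using (any?; ¬∀⟶∃¬)
open import Data.Fin.Subset using (Subset; _∈_; _⊂_)
import Data.Fin.Subset as Subset
open import Data.Fin.Subset.Properties using (p⊂q⇒∣p∣<∣q∣; _∈?_)
open import Data.List using (allFin)
open import Data.List.Membership.Propositional.Properties using (∈-allFin)
import Data.List.Relation.Unary.All as All
open import Data.Nat using (ℕ)
import Data.Nat as ℕ
open import Data.Nat.Induction using (<-wellFounded)
open import Data.Product using (_×_; _,_; ∃-syntax; proj₁; proj₂)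
open import Data.Rational
open import Data.Rational.Properties
open import Data.Rational.Solver using (module +-*-Solver)
open import Data.Sum using (_⊎_; inj₁; inj₂)
open import Data.Vec using (tabulate)
open import Data.Vec.Properties using (lookup∘tabulate; []=⇒lookup; lookup⇒[]=)
open import Function using (_∘_; case_of_)
open import Function.Bundles using (Equivalence)
open import Induction.WellFounded using (Acc; acc)
open import Relation.Binary.Bundles using (DecTotalOrder)
open import Relation.Binary.PropositionalEquality
open import Relation.Nullary using (¬_; Dec; yes; no; contradiction)
open import Relation.Nullary.Decidable using (_×-dec_; ¬?; isYes; toWitness; fromWitness)

open import Algebra.Properties.Semiring.Sum (Ring.semiring +-*-ring)
  using (sum; sum-cong-≗; ∑-distrib-+; *-distribˡ-sum; sum-replicate-zero)
open import Data.List.Extrema (DecTotalOrder.totalOrder ≤-decTotalOrder)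
  using (argmax; f[xs]≤f[argmax])

open +-*-Solver

p≤q⇒0≤q-p : ∀ {p q} → p ≤ q → 0ℚ ≤ q - p
p≤q⇒0≤q-p {p} {q} p≤q = subst (_≤ q - p) (+-inverseʳ p) (+-monoˡ-≤ (- p) p≤q)

0≤q-p⇒p≤q : ∀ {p q} → 0ℚ ≤ q - p → p ≤ q
0≤q-p⇒p≤q {p} {q} 0≤q-p =
  subst₂ _≤_ (+-identityˡ p) (solve 2 (λ p q → (q :- p) :+ p := q) refl p q) (+-monoˡ-≤ p 0≤q-p)

*-nonNeg : ∀ {p q} → 0ℚ ≤ p → 0ℚ ≤ q → 0ℚ ≤ p * q
*-nonNeg {p} {q} 0≤p 0≤q =
  nonNegative⁻¹ (p * q) {{nonNeg*nonNeg⇒nonNeg p {{nonNegative 0≤p}} q {{nonNegative 0≤q}}}}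

p≤∣p∣ : ∀ p → p ≤ ∣ p ∣
p≤∣p∣ p with 0ℚ ≤? p
... | yes 0≤p = ≤-reflexive (sym (0≤p⇒∣p∣≡p 0≤p))
... | no  0≰p = ≤-trans (<⇒≤ (≰⇒> 0≰p)) (0≤∣p∣ p)

-p≤∣p∣ : ∀ p → - p ≤ ∣ p ∣
-p≤∣p∣ p = subst (- p ≤_) (∣-p∣≡∣p∣ p) (p≤∣p∣ (- p))

p≢0⇒0<∣p∣ : ∀ {p} → p ≢ 0ℚ → 0ℚ < ∣ p ∣
p≢0⇒0<∣p∣ {p} p≢0 =
  positive⁻¹ ∣ p ∣ {{nonNeg∧nonZero⇒pos ∣ p ∣ {{∣-∣-nonNeg p}} {{≢-nonZero (p≢0 ∘ ∣p∣≡0⇒p≡0 p)}}}}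

0≤c⇒∣c*p∣≡c*∣p∣ : ∀ {c} p → 0ℚ ≤ c → ∣ c * p ∣ ≡ c * ∣ p ∣
0≤c⇒∣c*p∣≡c*∣p∣ {c} p 0≤c = trans (∣p*q∣≡∣p∣*∣q∣ c p) (cong (_* ∣ p ∣) (0≤p⇒∣p∣≡p 0≤c))

sum-mono-≤ : ∀ {m} {f g : Fin m → ℚ} → (∀ i → f i ≤ g i) → sum f ≤ sum g
sum-mono-≤ {ℕ.zero}  f≤g = ≤-refl
sum-mono-≤ {ℕ.suc m} f≤g = +-mono-≤ (f≤g zero) (sum-mono-≤ (f≤g ∘ suc))

argmax-Fin : ∀ {m} (f : Fin m → ℚ) → Fin m → ∃[ k ] ∀ i → f i ≤ f k
argmax-Fin f i₀ =
  argmax f i₀ (allFin _) , λ i → All.lookup (f[xs]≤f[argmax] i₀ (allFin _)) (∈-allFin i)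

_∈[0,1] : ℚ → Set
q ∈[0,1] = 0ℚ ≤ q × q ≤ 1ℚ

Interior : ℚ → Set
Interior q = 0ℚ < q × q < 1ℚ

interior? : ∀ q → Dec (Interior q)
interior? q = (0ℚ <? q) ×-dec (q <? 1ℚ)

HalfIntegral : ℚ → Set
HalfIntegral q = q ≡ 0ℚ ⊎ q ≡ ½ ⊎ q ≡ 1ℚ

boundary : ∀ {q} → q ∈[0,1] → ¬ Interior q → q ≡ 0ℚ ⊎ q ≡ 1ℚ
boundary {q} (0≤q , q≤1) ¬interior with 0ℚ <? q | q <? 1ℚ
... | no  0≮q | _       = inj₁ (≤-antisym (≮⇒≥ 0≮q) 0≤q)
... | yes _   | no  q≮1 = inj₂ (≤-antisym q≤1 (≮⇒≥ q≮1))
... | yes 0<q | yes q<1 = contradiction (0<q , q<1) ¬interior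

½+p∈[0,1] : ∀ {p} → ∣ p ∣ ≤ ½ → (½ + p) ∈[0,1]
½+p∈[0,1] {p} ∣p∣≤½ =
  subst (_≤ ½ + p) (+-inverseˡ p) (+-monoˡ-≤ p (≤-trans (-p≤∣p∣ p) ∣p∣≤½)) ,
  +-monoʳ-≤ ½ (≤-trans (p≤∣p∣ p) ∣p∣≤½)

q∈[0,1]⇒∣q-½∣≤½ : ∀ {q} → q ∈[0,1] → ∣ q - ½ ∣ ≤ ½
q∈[0,1]⇒∣q-½∣≤½ {q} (0≤q , q≤1) with ∣p∣≡p∨∣p∣≡-p (q - ½)
... | inj₁ ∣q-½∣≡q-½ = subst (_≤ ½) (sym ∣q-½∣≡q-½) (+-monoˡ-≤ (- ½) q≤1)
... | inj₂ ∣q-½∣≡½-q =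
  subst (_≤ ½) (trans (solve 1 (λ q → con ½ :- q := :- (q :- con ½)) refl q) (sym ∣q-½∣≡½-q))
        (+-monoʳ-≤ ½ (neg-antimono-≤ 0≤q))

∣p∣≡½⇒¬Interior[½+p] : ∀ {p} → ∣ p ∣ ≡ ½ → ¬ Interior (½ + p)
∣p∣≡½⇒¬Interior[½+p] {p} ∣p∣≡½ (0<½+p , ½+p<1) with ∣p∣≡p∨∣p∣≡-p p
... | inj₁ ∣p∣≡p  = <-irrefl refl (subst (_< 1ℚ) (cong (½ +_) (trans (sym ∣p∣≡p) ∣p∣≡½)) ½+p<1)
... | inj₂ ∣p∣≡-p = <-irrefl refl (subst (0ℚ <_) (trans (cong (½ +_) p≡-½) (+-inverseʳ ½)) 0<½+p)
  where
  p≡-½ : p ≡ - ½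
  p≡-½ = neg-injective (trans (sym ∣p∣≡-p) ∣p∣≡½)

covered-by-boundary⇒one : ∀ {p q} → Interior p → q ∈[0,1] → ¬ Interior q → 1ℚ ≤ p + q → q ≡ 1ℚ
covered-by-boundary⇒one {p} (_ , p<1) q∈[0,1] ¬interior 1≤p+q with boundary q∈[0,1] ¬interior
... | inj₁ refl = contradiction (<-≤-trans p<1 (subst (1ℚ ≤_) (+-identityʳ p) 1≤p+q)) (<-irrefl refl)
... | inj₂ q≡1  = q≡1

capped-cover : ∀ {p q} → 0ℚ ≤ p → 0ℚ ≤ q → 1ℚ ≤ p + q → 1ℚ ≤ p ⊓ 1ℚ + q ⊓ 1ℚ
capped-cover {p} {q} 0≤p 0≤q 1≤p+q with ≤-total p 1ℚ | ≤-total q 1ℚ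
... | inj₂ 1≤p | _        rewrite p≥q⇒p⊓q≡q 1≤p = +-monoʳ-≤ 1ℚ (⊓-glb 0≤q (≤ᵇ⇒≤ _))
... | inj₁ _   | inj₂ 1≤q rewrite p≥q⇒p⊓q≡q 1≤q = +-monoˡ-≤ 1ℚ (⊓-glb 0≤p (≤ᵇ⇒≤ _))
... | inj₁ p≤1 | inj₁ q≤1 rewrite p≤q⇒p⊓q≡p p≤1 | p≤q⇒p⊓q≡p q≤1 = 1≤p+q

deviation : ℚ → ℚ
deviation q with interior? q
... | yes _ = q - ½
... | no  _ = 0ℚ

stretch : ℚ → ℚ → ℚ
stretch c q with interior? q
... | yes _ = ½ + c * (q - ½)
... | no  _ = q

stretch-affine : ∀ c q → stretch c q ≡ stretch 0ℚ q + c * deviation q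
stretch-affine c q with interior? q
... | yes _ = solve 2 (λ c q → con ½ :+ c :* (q :- con ½)
                           := (con ½ :+ con 0ℚ :* (q :- con ½)) :+ c :* (q :- con ½)) refl c q
... | no  _ = solve 2 (λ c q → q := q :+ c :* con 0ℚ) refl c q

stretch-one : ∀ q → stretch 1ℚ q ≡ q
stretch-one q with interior? q
... | yes _ = solve 1 (λ q → con ½ :+ con 1ℚ :* (q :- con ½) := q) refl q
... | no  _ = refl

stretch-zero-halfIntegral : ∀ {q} → q ∈[0,1] → HalfIntegral (stretch 0ℚ q)
stretch-zero-halfIntegral {q} q∈[0,1] with interior? q
... | yes _ = inj₂ (inj₁ (solve 1 (λ q → con ½ :+ con 0ℚ :* (q :- con ½) := con ½) refl q))
... | no ¬interior with boundary q∈[0,1] ¬interior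
...   | inj₁ q≡0 = inj₁ q≡0
...   | inj₂ q≡1 = inj₂ (inj₂ q≡1)

∣deviation∣≤½ : ∀ q → ∣ deviation q ∣ ≤ ½
∣deviation∣≤½ q with interior? q
... | yes (0<q , q<1) = q∈[0,1]⇒∣q-½∣≤½ (<⇒≤ 0<q , <⇒≤ q<1)
... | no  _           = ≤ᵇ⇒≤ _

deviation≢0⇒Interior : ∀ {q} → deviation q ≢ 0ℚ → Interior q
deviation≢0⇒Interior {q} deviation≢0 with interior? q
... | yes interior = interior
... | no  _        = contradiction refl deviation≢0

Interior-stretch⁻ : ∀ {c q} → Interior (stretch c q) → Interior q
Interior-stretch⁻ {c} {q} with interior? q
... | yes interior = λ _ → interior
... | no  _        = λ interior → interior

½+c[q-½]∈[0,1] : ∀ {c} q → 0ℚ ≤ c → c * ∣ q - ½ ∣ ≤ ½ → (½ + c * (q - ½)) ∈[0,1]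
½+c[q-½]∈[0,1] {c} q 0≤c c∣q-½∣≤½ =
  ½+p∈[0,1] (subst (_≤ ½) (sym (0≤c⇒∣c*p∣≡c*∣p∣ (q - ½) 0≤c)) c∣q-½∣≤½)

stretch-∈[0,1] : ∀ {c q} → 0ℚ ≤ c → c * ∣ deviation q ∣ ≤ ½ → q ∈[0,1] → stretch c q ∈[0,1]
stretch-∈[0,1] {c} {q} 0≤c c∣deviation∣≤½ q∈[0,1] with interior? q
... | yes _ = ½+c[q-½]∈[0,1] q 0≤c c∣deviation∣≤½
... | no  _ = q∈[0,1]

stretch-leaves-interior : ∀ {c q} → 0ℚ ≤ c → c * ∣ deviation q ∣ ≡ ½ → ¬ Interior (stretch c q)
stretch-leaves-interior {c} {q} 0≤c c∣deviation∣≡½ with interior? q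
... | yes _         = ∣p∣≡½⇒¬Interior[½+p] (trans (0≤c⇒∣c*p∣≡c*∣p∣ (q - ½) 0≤c) c∣deviation∣≡½)
... | no  ¬interior = ¬interior

interiors-cover : ∀ {c p q} → 0ℚ ≤ c → 1ℚ ≤ p + q → 1ℚ ≤ (½ + c * (p - ½)) + (½ + c * (q - ½))
interiors-cover {c} {p} {q} 0≤c 1≤p+q = 0≤q-p⇒p≤q (subst (0ℚ ≤_)
  (solve 3 (λ c p q → c :* ((p :+ q) :- con 1ℚ)
                   := ((con ½ :+ c :* (p :- con ½)) :+ (con ½ :+ c :* (q :- con ½))) :- con 1ℚ) refl c p q)
  (*-nonNeg 0≤c (p≤q⇒0≤q-p 1≤p+q)))

stretch-cover : ∀ {c p q} → 0ℚ ≤ c → c * ∣ deviation p ∣ ≤ ½ → c * ∣ deviation q ∣ ≤ ½ →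
                p ∈[0,1] → q ∈[0,1] → 1ℚ ≤ p + q → 1ℚ ≤ stretch c p + stretch c q
stretch-cover {c} {p} {q} 0≤c c∣p∣≤½ c∣q∣≤½ p∈[0,1] q∈[0,1] 1≤p+q with interior? p | interior? q
... | yes _  | yes _  = interiors-cover {c} {p} {q} 0≤c 1≤p+q
... | yes p° | no ¬q° rewrite covered-by-boundary⇒one p° q∈[0,1] ¬q° 1≤p+q =
  +-monoˡ-≤ 1ℚ (proj₁ (½+c[q-½]∈[0,1] p 0≤c c∣p∣≤½))
... | no ¬p° | yes q° rewrite covered-by-boundary⇒one q° p∈[0,1] ¬p° (subst (1ℚ ≤_) (+-comm p q) 1≤p+q) =
  +-monoʳ-≤ 1ℚ (proj₁ (½+c[q-½]∈[0,1] q 0≤c c∣q∣≤½))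
... | no _   | no _   = 1≤p+q

stretch-factor : ∀ {ρ} → 0ℚ < ρ → ρ ≤ ½ → ∃[ c ] 1ℚ ≤ c × c * ρ ≡ ½
stretch-factor {ρ} 0<ρ ρ≤½ = ½ * ρ⁻¹ , 1≤½ρ⁻¹ , trans (*-assoc ½ ρ⁻¹ ρ) (cong (½ *_) (*-inverseˡ ρ))
  where
  instance
    ρ-positive : Positive ρ
    ρ-positive = positive 0<ρ
    ρ-nonZero : NonZero ρ
    ρ-nonZero = pos⇒nonZero ρ
  ρ⁻¹ : ℚ
  ρ⁻¹ = 1/ ρ
  1≤½ρ⁻¹ : 1ℚ ≤ ½ * ρ⁻¹
  1≤½ρ⁻¹ = subst (_≤ ½ * ρ⁻¹) (*-inverseʳ ρ)
                 (*-monoʳ-≤-nonNeg ρ⁻¹ {{pos⇒nonNeg ρ⁻¹ {{1/pos⇒pos ρ}}}} ρ≤½)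

module VertexCoverLP {m : ℕ} (R : Fin m → Fin m → Set) (w : Fin m → ℚ) where

  Cover : (Fin m → ℚ) → Set
  Cover y = ∀ e f → R e f → 1ℚ ≤ y e + y f

  InUnitCube : (Fin m → ℚ) → Set
  InUnitCube y = ∀ e → y e ∈[0,1]

  cost : (Fin m → ℚ) → ℚ
  cost y = sum (λ e → w e * y e)

  slope : (Fin m → ℚ) → ℚ
  slope y = cost (deviation ∘ y)

  cost-stretch : ∀ c y → cost (stretch c ∘ y) ≡ cost (stretch 0ℚ ∘ y) + c * slope y
  cost-stretch c y = begin
    cost (stretch c ∘ y)
      ≡⟨ sum-cong-≗ split ⟩
    sum (λ e → w e * stretch 0ℚ (y e) + c * (w e * deviation (y e)))
      ≡⟨ ∑-distrib-+ (λ e → w e * stretch 0ℚ (y e)) _ ⟩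
    cost (stretch 0ℚ ∘ y) + sum (λ e → c * (w e * deviation (y e)))
      ≡⟨ cong (cost (stretch 0ℚ ∘ y) +_) (*-distribˡ-sum c (λ e → w e * deviation (y e))) ⟨
    cost (stretch 0ℚ ∘ y) + c * slope y
      ∎
    where
    open ≡-Reasoning
    split : ∀ e → w e * stretch c (y e) ≡ w e * stretch 0ℚ (y e) + c * (w e * deviation (y e))
    split e = trans (cong (w e *_) (stretch-affine c (y e)))
                    (solve 4 (λ w s c d → w :* (s :+ c :* d) := w :* s :+ c :* (w :* d)) refl
                             (w e) (stretch 0ℚ (y e)) c (deviation (y e)))

  cost-stretch-one : ∀ y → cost (stretch 1ℚ ∘ y) ≡ cost y
  cost-stretch-one y = sum-cong-≗ (λ e → cong (w e *_) (stretch-one (y e)))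

  cost-stretch-zero≤ : ∀ {y} → 0ℚ ≤ slope y → cost (stretch 0ℚ ∘ y) ≤ cost y
  cost-stretch-zero≤ {y} 0≤slope = begin
    cost (stretch 0ℚ ∘ y)                  ≡⟨ +-identityʳ _ ⟨
    cost (stretch 0ℚ ∘ y) + 0ℚ             ≤⟨ +-monoʳ-≤ (cost (stretch 0ℚ ∘ y)) 0≤slope ⟩
    cost (stretch 0ℚ ∘ y) + slope y        ≡⟨ cong (cost (stretch 0ℚ ∘ y) +_) (*-identityˡ (slope y)) ⟨
    cost (stretch 0ℚ ∘ y) + 1ℚ * slope y   ≡⟨ cost-stretch 1ℚ y ⟨
    cost (stretch 1ℚ ∘ y)                  ≡⟨ cost-stretch-one y ⟩
    cost y                                 ∎
    where open ≤-Reasoning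

  cost-stretch≤ : ∀ {c y} → slope y ≤ 0ℚ → 1ℚ ≤ c → cost (stretch c ∘ y) ≤ cost y
  cost-stretch≤ {c} {y} slope≤0 1≤c = begin
    cost (stretch c ∘ y)                   ≡⟨ cost-stretch c y ⟩
    cost (stretch 0ℚ ∘ y) + c * slope y    ≤⟨ +-monoʳ-≤ (cost (stretch 0ℚ ∘ y))
                                                (*-monoʳ-≤-nonPos (slope y) {{nonPositive slope≤0}} 1≤c) ⟩
    cost (stretch 0ℚ ∘ y) + 1ℚ * slope y   ≡⟨ cost-stretch 1ℚ y ⟨
    cost (stretch 1ℚ ∘ y)                  ≡⟨ cost-stretch-one y ⟩
    cost y                                 ∎
    where open ≤-Reasoning

  slope<0⇒deviation≢0 : ∀ {y} → slope y < 0ℚ → ∃[ e ] deviation (y e) ≢ 0ℚ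
  slope<0⇒deviation≢0 {y} slope<0 =
    ¬∀⟶∃¬ m _ (λ e → deviation (y e) ≟ 0ℚ) (λ flat → <-irrefl (slope≡0 flat) slope<0)
    where
    slope≡0 : (∀ e → deviation (y e) ≡ 0ℚ) → slope y ≡ 0ℚ
    slope≡0 flat = trans (sum-cong-≗ (λ e → trans (cong (w e *_) (flat e)) (*-zeroʳ (w e))))
                         (sum-replicate-zero m)

  interiorOf : (Fin m → ℚ) → Subset m
  interiorOf y = tabulate (λ e → isYes (interior? (y e)))

  ∈-interiorOf⁺ : ∀ {y e} → Interior (y e) → e ∈ interiorOf y
  ∈-interiorOf⁺ {y} {e} interior =
    lookup⇒[]= e _ (trans (lookup∘tabulate _ e) (Equivalence.to Bool.T-≡ (fromWitness interior)))

  ∈-interiorOf⁻ : ∀ {y e} → e ∈ interiorOf y → Interior (y e)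
  ∈-interiorOf⁻ {y} {e} e∈ =
    toWitness (Equivalence.from Bool.T-≡ (trans (sym (lookup∘tabulate _ e)) ([]=⇒lookup e∈)))

  stretch-preserves-cover : ∀ {c y} → 0ℚ ≤ c → (∀ e → c * ∣ deviation (y e) ∣ ≤ ½) →
                            InUnitCube y → Cover y → Cover (stretch c ∘ y)
  stretch-preserves-cover 0≤c admissible cube cover e f eRf =
    stretch-cover 0≤c (admissible e) (admissible f) (cube e) (cube f) (cover e f eRf)

  FewerInteriorCover : (Fin m → ℚ) → Set
  FewerInteriorCover y =
    ∃[ y′ ] InUnitCube y′ × Cover y′ × cost y′ ≤ cost y × interiorOf y′ ⊂ interiorOf y

  extremal-stretch : ∀ {y c} e* → InUnitCube y → Cover y → slope y ≤ 0ℚ →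
                     (∀ e → ∣ deviation (y e) ∣ ≤ ∣ deviation (y e*) ∣) → deviation (y e*) ≢ 0ℚ →
                     1ℚ ≤ c → c * ∣ deviation (y e*) ∣ ≡ ½ → FewerInteriorCover y
  extremal-stretch {y} {c} e* cube cover slope≤0 maximal deviation≢0 1≤c c∣deviation∣≡½ =
    stretch c ∘ y ,
    (λ e → stretch-∈[0,1] 0≤c (admissible e) (cube e)) ,
    stretch-preserves-cover 0≤c admissible cube cover ,
    cost-stretch≤ slope≤0 1≤c ,
    (λ e∈ → ∈-interiorOf⁺ {y} (Interior-stretch⁻ {c} (∈-interiorOf⁻ {stretch c ∘ y} e∈))) ,
    e* , ∈-interiorOf⁺ {y} (deviation≢0⇒Interior deviation≢0) ,
    λ e*∈ → stretch-leaves-interior {c} {y e*} 0≤c c∣deviation∣≡½ (∈-interiorOf⁻ {stretch c ∘ y} e*∈)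
    where
    0≤c : 0ℚ ≤ c
    0≤c = ≤-trans (≤ᵇ⇒≤ _) 1≤c
    admissible : ∀ e → c * ∣ deviation (y e) ∣ ≤ ½
    admissible e = subst (c * ∣ deviation (y e) ∣ ≤_) c∣deviation∣≡½
                         (*-monoˡ-≤-nonNeg c {{nonNegative 0≤c}} (maximal e))

  -- case_of_ rather than with: with-abstracting these existentials over goals that
  -- mention stretch and deviation exhausts the type checker.
  stretch-step : ∀ {y} → InUnitCube y → Cover y → slope y < 0ℚ → FewerInteriorCover y
  stretch-step {y} cube cover slope<0 =
    case slope<0⇒deviation≢0 {y} slope<0 of λ { (e₀ , deviation[e₀]≢0) →
    case argmax-Fin (∣_∣ ∘ deviation ∘ y) e₀ of λ { (e* , maximal) →
    let 0<∣deviation[e*]∣ = <-≤-trans (p≢0⇒0<∣p∣ deviation[e₀]≢0) (maximal e₀) in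
    case stretch-factor 0<∣deviation[e*]∣ (∣deviation∣≤½ (y e*)) of λ { (c , 1≤c , c∣deviation∣≡½) →
    extremal-stretch {y} e* cube cover (<⇒≤ slope<0) maximal
      (λ deviation≡0 → <-irrefl (sym (cong ∣_∣ deviation≡0)) 0<∣deviation[e*]∣) 1≤c c∣deviation∣≡½ } } }

  CheaperHalfIntegralCover : (Fin m → ℚ) → Set
  CheaperHalfIntegralCover y = ∃[ z ] (∀ e → HalfIntegral (z e)) × Cover z × cost z ≤ cost y

  unitCube-rounding : ∀ y → Acc ℕ._<_ (Subset.∣ interiorOf y ∣) → InUnitCube y → Cover y →
                      CheaperHalfIntegralCover y
  unitCube-rounding y (acc smaller) cube cover with 0ℚ ≤? slope y
  ... | yes 0≤slope =
    stretch 0ℚ ∘ y ,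
    (λ e → stretch-zero-halfIntegral (cube e)) ,
    stretch-preserves-cover {0ℚ} {y} ≤-refl
      (λ e → subst (_≤ ½) (sym (*-zeroˡ ∣ deviation (y e) ∣)) (≤ᵇ⇒≤ _)) cube cover ,
    cost-stretch-zero≤ {y} 0≤slope
  ... | no 0≰slope =
    case stretch-step cube cover (≰⇒> 0≰slope) of λ { (y′ , cube′ , cover′ , y′≤y , y′⊂y) →
    case unitCube-rounding y′ (smaller (p⊂q⇒∣p∣<∣q∣ y′⊂y)) cube′ cover′ of λ { (z , half , z-cover , z≤y′) →
    z , half , z-cover , ≤-trans z≤y′ y′≤y } }

  halfIntegral-cover : (∀ e → 0ℚ ≤ w e) → ∀ y → (∀ e → 0ℚ ≤ y e) → Cover y → CheaperHalfIntegralCover y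
  halfIntegral-cover w≥0 y y≥0 cover =
    case unitCube-rounding capped (<-wellFounded _) cube capped-covers of λ { (z , half , z-cover , z≤capped) →
    z , half , z-cover , ≤-trans z≤capped capped≤y }
    where
    capped : Fin m → ℚ
    capped e = y e ⊓ 1ℚ
    cube : InUnitCube capped
    cube e = ⊓-glb (y≥0 e) (≤ᵇ⇒≤ _) , p⊓q≤q (y e) 1ℚ
    capped-covers : Cover capped
    capped-covers e f eRf = capped-cover (y≥0 e) (y≥0 f) (cover e f eRf)
    capped≤y : cost capped ≤ cost y
    capped≤y = sum-mono-≤ (λ e → *-monoˡ-≤-nonNeg (w e) {{nonNegative (w≥0 e)}} (p⊓q≤p (y e) 1ℚ))

isYes-mono : ∀ {a b} {A : Set a} {B : Set b} {a? : Dec A} {b? : Dec B} → (A → B) → isYes a? Bool.≤ isYes b?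
isYes-mono {a? = no _}  {b?}         _   = Bool.≤-minimum (isYes b?)
isYes-mono {a? = yes _} {b? = yes _} _   = Bool.≤-refl
isYes-mono {a? = yes a} {b? = no ¬b} A→B = contradiction (A→B a) ¬b

halfIntegral≥1⇒≡1 : ∀ {q} → HalfIntegral q → 1ℚ ≤ q → q ≡ 1ℚ
halfIntegral≥1⇒≡1 (inj₁ refl)        1≤0 = ⊥-elim (≤⇒≤ᵇ 1≤0)
halfIntegral≥1⇒≡1 (inj₂ (inj₁ refl)) 1≤½ = ⊥-elim (≤⇒≤ᵇ 1≤½)
halfIntegral≥1⇒≡1 (inj₂ (inj₂ q≡1))  _   = q≡1

pair-cover : ∀ {p q r s} → q ≤ r → s ≤ p → 1ℚ ≤ ½ * (p - q + 1ℚ) + ½ * (r - s + 1ℚ)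
pair-cover {p} {q} {r} {s} q≤r s≤p = 0≤q-p⇒p≤q (subst (0ℚ ≤_)
  (solve 4 (λ p q r s → con ½ :* ((r :- q) :+ (p :- s))
                     := (con ½ :* (p :- q :+ con 1ℚ) :+ con ½ :* (r :- s :+ con 1ℚ)) :- con 1ℚ) refl p q r s)
  (*-nonNeg {½} {(r - q) + (p - s)} (≤ᵇ⇒≤ _) (+-mono-≤ (p≤q⇒0≤q-p q≤r) (p≤q⇒0≤q-p s≤p))))

Σℚ≡sum : ∀ H {j} (f : Fin j → ℚ) → Σℚ H f ≡ sum f
Σℚ≡sum H {ℕ.zero}  f = refl
Σℚ≡sum H {ℕ.suc j} f = cong (f zero +_) (Σℚ≡sum H (f ∘ suc))

module _ (H : Hypergraph) where
  open Hypergraph H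
  open VertexCoverLP (Bad H) w

  bit-mono : ∀ {a b} → a Bool.≤ b → bit H a ≤ bit H b
  bit-mono Bool.b≤b = ≤-refl
  bit-mono Bool.f≤t = ≤ᵇ⇒≤ _

  half-gap-nonNeg : ∀ a b → 0ℚ ≤ ½ * (bit H b - bit H a + 1ℚ)
  half-gap-nonNeg false false = ≤ᵇ⇒≤ _
  half-gap-nonNeg false true  = ≤ᵇ⇒≤ _
  half-gap-nonNeg true  false = ≤ᵇ⇒≤ _
  half-gap-nonNeg true  true  = ≤ᵇ⇒≤ _

  xOf-feasible : ∀ {s} → CPFeasible H s → VCFeasible H (xOf H s)
  xOf-feasible {s} (at-edge , at-node) = covers , λ e → half-gap-nonNeg (aE e) (bE e)
    where
    open CPVars s
    covers : Cover (xOf H s)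
    covers e f ((u , u∈e , u∈f) , ℓe≢ℓf) = pair-cover (bit-mono aₑ≤b_f) (bit-mono a_f≤bₑ)
      where
      colours = at-node u (ℓ e) (ℓ f) (e , u∈e , refl) (f , u∈f , refl) ℓe≢ℓf
      aₑ≤b_f = Bool.≤-trans (proj₁ (at-edge e u u∈e)) (Bool.≤-trans (proj₁ colours) (proj₂ (at-edge f u u∈f)))
      a_f≤bₑ = Bool.≤-trans (proj₁ (at-edge f u u∈f)) (Bool.≤-trans (proj₂ colours) (proj₂ (at-edge e u u∈e)))

  zeroEdgeOfColour? : (z : Fin m → ℚ) (u : Fin n) (i : Fin k) →
                      Dec (∃[ e ] u ∈ edge e × ℓ e ≡ i × z e ≡ 0ℚ)
  zeroEdgeOfColour? z u i = any? (λ e → u ∈? edge e ×-dec ℓ e Fin.≟ i ×-dec z e ≟ 0ℚ)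

  zeroEdgeNotOfColour? : (z : Fin m → ℚ) (u : Fin n) (j : Fin k) →
                         Dec (∃[ e ] u ∈ edge e × ℓ e ≢ j × z e ≡ 0ℚ)
  zeroEdgeNotOfColour? z u j = any? (λ e → u ∈? edge e ×-dec ¬? (ℓ e Fin.≟ j) ×-dec z e ≟ 0ℚ)

  toCPVars : (Fin m → ℚ) → CPVars H
  toCPVars z = record
    { aV = λ u i → isYes (zeroEdgeOfColour? z u i)
    ; bV = λ u j → isYes (zeroEdgeNotOfColour? z u j)
    ; aE = λ e → isYes (z e ≟ 0ℚ)
    ; bE = λ e → isYes (z e ≟ 1ℚ)
    }

  toCPVars-feasible : ∀ {z} → (∀ e → HalfIntegral (z e)) → Cover z → CPFeasible H (toCPVars z)
  toCPVars-feasible {z} half cover = at-edge , at-node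
    where
    at-edge : ∀ e u → u ∈ edge e →
              (isYes (z e ≟ 0ℚ) Bool.≤ isYes (zeroEdgeOfColour? z u (ℓ e)))
              × (isYes (zeroEdgeNotOfColour? z u (ℓ e)) Bool.≤ isYes (z e ≟ 1ℚ))
    at-edge e u u∈e =
      isYes-mono (λ ze≡0 → e , u∈e , refl , ze≡0) ,
      isYes-mono (λ { (f , u∈f , ℓf≢ℓe , zf≡0) →
        halfIntegral≥1⇒≡1 (half e)
          (subst (1ℚ ≤_) (trans (cong (_+ z e) zf≡0) (+-identityˡ (z e)))
                 (cover f e ((u , u∈f , u∈e) , ℓf≢ℓe))) })
    other-colour : ∀ {u i j} → i ≢ j →
                   isYes (zeroEdgeOfColour? z u i) Bool.≤ isYes (zeroEdgeNotOfColour? z u j)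
    other-colour i≢j = isYes-mono (λ { (e , u∈e , ℓe≡i , ze≡0) →
      e , u∈e , (λ ℓe≡j → i≢j (trans (sym ℓe≡i) ℓe≡j)) , ze≡0 })
    at-node : ∀ u i j → InC H u i → InC H u j → i ≢ j →
              (isYes (zeroEdgeOfColour? z u i) Bool.≤ isYes (zeroEdgeNotOfColour? z u j))
              × (isYes (zeroEdgeOfColour? z u j) Bool.≤ isYes (zeroEdgeNotOfColour? z u i))
    at-node u i j _ _ i≢j = other-colour i≢j , other-colour (i≢j ∘ sym)

  xOf-toCPVars : ∀ {z} e → HalfIntegral (z e) → xOf H (toCPVars z) e ≡ z e
  xOf-toCPVars e (inj₁ ze≡0)        rewrite ze≡0 = refl
  xOf-toCPVars e (inj₂ (inj₁ ze≡½)) rewrite ze≡½ = refl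
  xOf-toCPVars e (inj₂ (inj₂ ze≡1)) rewrite ze≡1 = refl

  CPObj-toCPVars : ∀ {z} → (∀ e → HalfIntegral (z e)) → CPObj H (toCPVars z) ≡ cost z
  CPObj-toCPVars {z} half =
    trans (Σℚ≡sum H (λ e → w e * xOf H (toCPVars z) e))
          (sum-cong-≗ (λ e → cong (w e *_) (xOf-toCPVars {z} e (half e))))

theorem3 : (H : Hypergraph) (s : CPVars H) → CPOptimal H s → VCOptimal H (xOf H s)
theorem3 H s (s-feasible , s-optimal) = xOf-feasible H s-feasible , optimal
  where
  open Hypergraph H
  open VertexCoverLP (Bad H) w
  optimal : ∀ y → VCFeasible H y → VCObj H (xOf H s) ≤ VCObj H y
  optimal y (y-cover , y≥0) with halfIntegral-cover w≥0 y y≥0 y-cover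
  ... | z , z-half , z-cover , z≤y = begin
    CPObj H s                ≤⟨ s-optimal (toCPVars H z) (toCPVars-feasible H z-half z-cover) ⟩
    CPObj H (toCPVars H z)   ≡⟨ CPObj-toCPVars H z-half ⟩
    cost z                   ≤⟨ z≤y ⟩
    cost y                   ≡⟨ Σℚ≡sum H (λ e → w e * y e) ⟨
    VCObj H y                ∎
    where open ≤-Reasoning
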